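{- Let $p$ be an even positive integer, $\mu=\frac{p^2}{4}+2p+2$, $\gamma=2\mu-\left(\frac{p}{2}+4\right)$ and $S(p)=\langle \mu,\gamma,\gamma+1\rangle_{p\mu}$. Then $$\mathrm{W}(S(p))=\frac{p^5}{192}+\frac{5p^4}{64}+\frac{p^3}{4}-\frac{7p^2}{16}+\frac{p}{6}.$$ In particular, $\mathrm{W}(S(p))>0$.
   Context: A numerical semigroup is a submonoid of $(\mathbb N,+)$ with finite complement. For integers $a_1,\dots,a_r$ and $t$, $\langle a_1,\dots,a_r\rangle_t$ denotes the smallest numerical semigroup containing $a_1,\dots,a_r$ and all integers $\ge t$. For a numerical semigroup $S$ with conductor $c$ (smallest integer such that all integers $\ge c$ are in $S$), let $L=\{s\in S:s<c\}$ and $P$ the set of minimal generators. The Wilf number is $\mathrm{W}(S)=|P|\,|L|-c$. -}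

module Defs where

open import Data.Nat using (ℕ; zero; suc; _+_; _*_; _∸_; _≤_; _<_; _/_)
open import Data.Integer as ℤ using (ℤ; +_)
open import Data.List using (List; []; _∷_; length)
open import Data.List.Relation.Unary.Unique.Propositional using (Unique)
open import Data.List.Membership.Propositional using (_∈_)
open import Data.Product using (Σ; ∃; _×_; _,_)
open import Data.Sum using (_⊎_)
open import Relation.Nullary using (¬_)
open import Relation.Binary.PropositionalEquality using (_≡_; _≢_)
open import Function.Bundles using (_⇔_)

NSet : Set₁
NSet = ℕ → Set

Combo : List ℕ → ℕ → Set
Combo []       x = x ≡ 0
Combo (a ∷ as) x = Σ ℕ λ k → Σ ℕ λ y → Combo as y × x ≡ k * a + y

-- ⟨ a₁,…,a_r ⟩_t : the smallest numerical semigroup containing the a_i and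
-- all integers ≥ t; explicitly, the ℕ-combinations of the a_i together with [t,∞).
⟨_⟩_ : List ℕ → ℕ → NSet
(⟨ A ⟩ t) x = Combo A x ⊎ t ≤ x

IsConductor : NSet → ℕ → Set
IsConductor S c = (∀ n → c ≤ n → S n) × (∀ d → (∀ n → d ≤ n → S n) → c ≤ d)

SmallElem : NSet → ℕ → NSet
SmallElem S c x = S x × x < c

MinGen : NSet → NSet
MinGen S x = S x × x ≢ 0 ×
  ¬ (Σ ℕ λ y → Σ ℕ λ z → S y × S z × y ≢ 0 × z ≢ 0 × x ≡ y + z)

-- the list xs enumerates the set P without repetition (so |P| = length xs)
Enumerates : NSet → List ℕ → Set
Enumerates P xs = Unique xs × (∀ x → (x ∈ xs) ⇔ P x)

IsWilfNumber : NSet → ℤ → Set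
IsWilfNumber S w =
  Σ ℕ λ c → Σ (List ℕ) λ Ls → Σ (List ℕ) λ Ps →
    IsConductor S c × Enumerates (SmallElem S c) Ls × Enumerates (MinGen S) Ps ×
    w ≡ + (length Ps * length Ls) ℤ.- + c

μ : ℕ → ℕ
μ p = (p / 2) * (p / 2) + 2 * p + 2

γ : ℕ → ℕ
γ p = 2 * μ p ∸ (p / 2 + 4)

Sp : ℕ → NSet
Sp p = ⟨ μ p ∷ γ p ∷ suc (γ p) ∷ [] ⟩ (p * μ p)

module Submission where

-- Write p = 2q with q = n + 1, and put e = q + 3 and d = q + 4, so that μ = qd + 2, γ = qe + qd = 2μ − d
-- and t = pμ.  Because γ + d = 2μ, the combination aμ + bγ + c(γ + 1) equals Mμ − kd + j with k = b + c,
-- M = a + 2k and j = c ≤ k, and conversely every such number with 2k ≤ M is a combination.  As qd < μ,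
-- for k ≤ q the segment [Mμ − kd, Mμ − kd + k] lies in the window (Mμ − μ, Mμ], and segments with distinct
-- (M, k) are disjoint.  Below t only k ≤ q occurs, so L consists of the segments k ≤ M/2 of the windows
-- M < p together with the segments 1 ≤ k ≤ q of window p; hence 6|L| = 2q(q+1)(q+2) + 3q(q+3), and
-- t − 1 ∉ S.  The minimal generators are μ, γ, γ + 1 and those t + s with 0 < s < μ that are not
-- combinations; writing s = ie + u with u < e, these are exactly the s with i < q and u ≤ i + 1, all other
-- s lying in a segment of window p + 1 or p + 2.  So 2|P| = q² + 3q + 4, and the value of the Wilf number
-- |P||L| − t is a polynomial identity.

open import Defs hiding (μ; γ)
open import Data.Nat using (ℕ; _<_)
open import Data.Nat.Divisibility using (_∣_)
open import Data.Product using (Σ; _×_)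
open import Relation.Binary.PropositionalEquality using (_≡_)

module ConcatUpTo where

  open import Data.Nat using (zero; suc; _+_; _*_)
  open import Data.Nat.Properties using (<⇒≢; +-cancelˡ-≡; *-distribˡ-+)
  open import Data.Nat.Tactic.RingSolver using (solve-∀)
  open import Data.List using (List; []; _++_; [_]; concat; applyUpTo; length)
  open import Data.List.Properties using (applyUpTo-∷ʳ; concat-++; ++-identityʳ; length-++)
  open import Data.List.Membership.Propositional using (_∈_)
  open import Data.List.Membership.Propositional.Properties
    using (∈-concat⁺′; ∈-concat⁻′; ∈-applyUpTo⁺; ∈-applyUpTo⁻)
  import Data.List.Relation.Unary.All.Properties as All
  import Data.List.Relation.Unary.AllPairs.Properties as AllPairs
  open import Data.List.Relation.Unary.Unique.Propositional using (Unique)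
  import Data.List.Relation.Unary.Unique.Propositional.Properties as Unique
  open import Data.List.Relation.Binary.Disjoint.Propositional using (Disjoint)
  open import Data.Product using (∃; _,_)
  open import Function using (_∘_)
  open import Relation.Binary.PropositionalEquality using (refl; trans; cong; module ≡-Reasoning)

  module _ {A : Set} where

    concatUpTo : (ℕ → List A) → ℕ → List A
    concatUpTo f n = concat (applyUpTo f n)

    concatUpTo-suc : ∀ f n → concatUpTo f (suc n) ≡ concatUpTo f n ++ f n
    concatUpTo-suc f n = begin
      concat (applyUpTo f (suc n))          ≡⟨ cong concat (applyUpTo-∷ʳ f n) ⟨
      concat (applyUpTo f n ++ [ f n ])     ≡⟨ concat-++ (applyUpTo f n) [ f n ] ⟨
      concatUpTo f n ++ (f n ++ [])         ≡⟨ cong (concatUpTo f n ++_) (++-identityʳ (f n)) ⟩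
      concatUpTo f n ++ f n                 ∎
      where open ≡-Reasoning

    length-concatUpTo-suc : ∀ f n → length (concatUpTo f (suc n)) ≡ length (concatUpTo f n) + length (f n)
    length-concatUpTo-suc f n = trans (cong length (concatUpTo-suc f n)) (length-++ (concatUpTo f n))

    length-concatUpTo-linear : ∀ {f} b → (∀ i → length (f i) ≡ suc (b + i)) →
                               ∀ n → 2 * length (concatUpTo f n) ≡ n * (n + 2 * b + 1)
    length-concatUpTo-linear b length-f zero = refl
    length-concatUpTo-linear {f} b length-f (suc n) = begin
      2 * length (concatUpTo f (suc n))      ≡⟨ cong (2 *_) (length-concatUpTo-suc f n) ⟩
      2 * (|F| + length (f n))               ≡⟨ cong (λ l → 2 * (|F| + l)) (length-f n) ⟩
      2 * (|F| + suc (b + n))                ≡⟨ *-distribˡ-+ 2 |F| (suc (b + n)) ⟩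
      2 * |F| + 2 * suc (b + n)              ≡⟨ cong (_+ 2 * suc (b + n)) (length-concatUpTo-linear b length-f n) ⟩
      n * (n + 2 * b + 1) + 2 * suc (b + n)  ≡⟨ identity n b ⟩
      suc n * (suc n + 2 * b + 1)            ∎
      where
        open ≡-Reasoning
        |F| = length (concatUpTo f n)
        identity : ∀ n b → n * (n + 2 * b + 1) + 2 * suc (b + n) ≡ suc n * (suc n + 2 * b + 1)
        identity = solve-∀

    ∈-concatUpTo⁺ : ∀ {f n i x} → i < n → x ∈ f i → x ∈ concatUpTo f n
    ∈-concatUpTo⁺ {f} i<n x∈fi = ∈-concat⁺′ x∈fi (∈-applyUpTo⁺ f i<n)

    ∈-concatUpTo⁻ : ∀ {f n x} → x ∈ concatUpTo f n → ∃ λ i → i < n × x ∈ f i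
    ∈-concatUpTo⁻ {f} {n} x∈ with ∈-concat⁻′ (applyUpTo f n) x∈
    ... | xs , x∈xs , xs∈ with ∈-applyUpTo⁻ f xs∈
    ...   | i , i<n , refl = i , i<n , x∈xs

    concatUpTo-unique : ∀ {f n} → (∀ {i} → i < n → Unique (f i)) →
                        (∀ {i j} → i < j → j < n → Disjoint (f i) (f j)) → Unique (concatUpTo f n)
    concatUpTo-unique {f} {n} unique disjoint =
      Unique.concat⁺ (All.applyUpTo⁺₁ f n unique) (AllPairs.applyUpTo⁺₁ f n disjoint)

  shiftedUpTo-unique : ∀ a n → Unique (applyUpTo (a +_) n)
  shiftedUpTo-unique a n = Unique.applyUpTo⁺₁ (a +_) n λ i<j _ → <⇒≢ i<j ∘ +-cancelˡ-≡ a _ _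

module NumericalSemigroup where

  open import Data.Nat using (zero; suc; _+_; _*_; _∸_; _≤_; _<?_)
  open import Data.Nat.Properties
  open import Data.Nat.Tactic.RingSolver using (solve-∀)
  open import Data.List using (List; []; _∷_)
  open import Data.List.Membership.Propositional using (_∈_)
  open import Data.List.Relation.Unary.Any using (here; there)
  open import Data.Product using (_,_)
  open import Data.Sum using (_⊎_; inj₁; inj₂)
  open import Data.Empty using (⊥-elim)
  open import Relation.Nullary using (¬_; yes; no)
  open import Relation.Binary.PropositionalEquality using (_≢_; refl; sym; trans; cong; subst)

  combo-zero : ∀ A → Combo A 0
  combo-zero []       = refl
  combo-zero (a ∷ as) = 0 , 0 , combo-zero as , refl

  combo-∈ : ∀ {A a} → a ∈ A → Combo A a
  combo-∈ {a ∷ as} (here refl) = 1 , 0 , combo-zero as , sym (trans (+-identityʳ (a + 0)) (+-identityʳ a))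
  combo-∈ (there a∈as)         = 0 , _ , combo-∈ a∈as , refl

  combo-+ : ∀ {A x y} → Combo A x → Combo A y → Combo A (x + y)
  combo-+ {[]}     refl refl = refl
  combo-+ {a ∷ as} (k , u , cu , refl) (l , v , cv , refl) = k + l , u + v , combo-+ cu cv , regroup k l a u v
    where
      regroup : ∀ k l a u v → k * a + u + (l * a + v) ≡ (k + l) * a + (u + v)
      regroup = solve-∀

  combo-split : ∀ {A x} → Combo A x → x ≢ 0 → Σ ℕ λ a → a ∈ A × Σ ℕ λ w → Combo A w × x ≡ a + w
  combo-split {[]}     refl                    x≢0 = ⊥-elim (x≢0 refl)
  combo-split {a ∷ as} (suc k , u , cu , refl) _   =
    a , here refl , k * a + u , (k , u , cu , refl) , +-assoc a (k * a) u
  combo-split {a ∷ as} (zero , u , cu , refl)  x≢0 with combo-split cu x≢0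
  ... | b , b∈as , w , cw , refl = b , there b∈as , w , (0 , w , cw , refl) , refl

  isConductor-suc : ∀ {S : NSet} {c} → (∀ x → suc c ≤ x → S x) → ¬ S c → IsConductor S (suc c)
  isConductor-suc above c∉S = above , λ c′ above-c′ → ≰⇒> (λ c′≤c → c∉S (above-c′ _ c′≤c))

  module MinimalGenerators {A : List ℕ} {t m : ℕ} (m∈A : m ∈ A) (0<m : 0 < m)
      (m≤A : ∀ {a} → a ∈ A → m ≤ a) (A<2m : ∀ {a} → a ∈ A → a < 2 * m)
      (A<t : ∀ {a} → a ∈ A → a < t) where

    private
      S : NSet
      S = ⟨ A ⟩ t

      m≢0 : ∀ {x} → m ≤ x → x ≢ 0
      m≢0 m≤x refl = <⇒≱ 0<m m≤x

    nonzero⇒≥m : ∀ {x} → S x → x ≢ 0 → m ≤ x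
    nonzero⇒≥m (inj₁ cx) x≢0 with combo-split cx x≢0
    ... | a , a∈A , w , _ , refl = ≤-trans (m≤A a∈A) (m≤m+n a w)
    nonzero⇒≥m (inj₂ t≤x) _ = ≤-trans (<⇒≤ (A<t m∈A)) t≤x

    IsSum : ℕ → Set
    IsSum x = Σ ℕ λ y → Σ ℕ λ z → S y × S z × y ≢ 0 × z ≢ 0 × x ≡ y + z

    sum⇒≥2m : ∀ {x} → IsSum x → 2 * m ≤ x
    sum⇒≥2m (y , z , sy , sz , y≢0 , z≢0 , refl) =
      subst (_≤ y + z) (cong (m +_) (sym (+-identityʳ m)))
            (+-mono-≤ (nonzero⇒≥m sy y≢0) (nonzero⇒≥m sz z≢0))

    minGen-∈ : ∀ {a} → a ∈ A → MinGen S a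
    minGen-∈ a∈A = inj₁ (combo-∈ a∈A) , m≢0 (m≤A a∈A) , λ sum → <⇒≱ (A<2m a∈A) (sum⇒≥2m sum)

    minGen-above : ∀ {x} → t ≤ x → x < t + m → ¬ Combo A x → MinGen S x
    minGen-above {x} t≤x x<t+m x∉C = inj₂ t≤x , m≢0 (≤-trans (<⇒≤ (A<t m∈A)) t≤x) , not-sum
      where
        below-t : ∀ {y z} → S z → z ≢ 0 → x ≡ y + z → y < t
        below-t sz z≢0 refl = +-cancelʳ-< _ _ _ (<-≤-trans x<t+m (+-monoʳ-≤ t (nonzero⇒≥m sz z≢0)))
        combo : ∀ {y} → S y → y < t → Combo A y
        combo (inj₁ cy) _   = cy
        combo (inj₂ t≤y) y<t = ⊥-elim (<⇒≱ y<t t≤y)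
        not-sum : ¬ IsSum x
        not-sum (y , z , sy , sz , y≢0 , z≢0 , refl) =
          x∉C (combo-+ (combo sy (below-t sz z≢0 refl)) (combo sz (below-t sy y≢0 (+-comm y z))))

    generator+combo-sum : ∀ {a w} → a ∈ A → Combo A (suc w) → IsSum (a + suc w)
    generator+combo-sum a∈A cw = _ , _ , inj₁ (combo-∈ a∈A) , inj₁ cw , m≢0 (m≤A a∈A) , (λ ()) , refl

    minGen-cases : ∀ {x} → MinGen S x → x ∈ A ⊎ (t ≤ x × x < t + m × ¬ Combo A x)
    minGen-cases (inj₁ cx , x≢0 , not-sum) with combo-split cx x≢0
    ... | a , a∈A , zero  , _  , refl = inj₁ (subst (_∈ A) (sym (+-identityʳ a)) a∈A)
    ... | a , a∈A , suc w , cw , refl = ⊥-elim (not-sum (generator+combo-sum a∈A cw))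
    minGen-cases {x} (inj₂ t≤x , x≢0 , not-sum) with x <? t + m
    ... | no  x≮t+m = ⊥-elim (not-sum (m , x ∸ m , inj₁ (combo-∈ m∈A) , inj₂ t≤x∸m , m≢0 ≤-refl ,
                                       m≢0 (≤-trans (<⇒≤ (A<t m∈A)) t≤x∸m) , sym (m+[n∸m]≡n m≤x)))
      where
        m≤x : m ≤ x
        m≤x = ≤-trans (m≤n+m m t) (≮⇒≥ x≮t+m)
        t≤x∸m : t ≤ x ∸ m
        t≤x∸m = m+n≤o⇒m≤o∸n t (≮⇒≥ x≮t+m)
    ... | yes x<t+m = inj₂ (t≤x , x<t+m , x∉C)
      where
        x∉C : ¬ Combo A x
        x∉C cx with combo-split cx x≢0
        ... | a , a∈A , zero  , _  , refl = <⇒≱ (A<t a∈A) (subst (t ≤_) (+-identityʳ a) t≤x)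
        ... | a , a∈A , suc w , cw , refl = not-sum (generator+combo-sum a∈A cw)

module SemigroupSp (n : ℕ) where

  open import Data.Nat using (zero; suc; _+_; _*_; _∸_; _≤_; _>_; z≤n; s≤s; z<s; s<s; _≤?_; _/_; pred)
  open import Data.Nat.Properties
  open import Data.Nat.DivMod using (_%_; m≡m%n+[m/n]*n; m%n<n; m*n/n≡m; m/n*n≤m; /-monoˡ-≤; +-distrib-/-∣ʳ)
  open import Data.Nat.Divisibility using (divides)
  open import Data.Nat.Tactic.RingSolver using (solve-∀)
  open import Algebra.Properties.CommutativeSemigroup +-commutativeSemigroup
    using (xy∙z≈xz∙y; xy∙z≈x∙zy; xy∙z≈y∙xz)
  open import Data.List using (List; []; _∷_; _++_; applyUpTo; length)
  open import Data.List.Properties using (length-applyUpTo; length-++)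
  open import Data.List.Membership.Propositional using (_∈_)
  open import Data.List.Membership.Propositional.Properties
    using (∈-applyUpTo⁺; ∈-applyUpTo⁻; ∈-++⁺ˡ; ∈-++⁺ʳ; ∈-++⁻)
  open import Data.List.Relation.Unary.Any using (here; there)
  import Data.List.Relation.Unary.All as All
  open import Data.List.Relation.Unary.All using ([]; _∷_)
  open import Data.List.Relation.Unary.AllPairs using ([]; _∷_)
  open import Data.List.Relation.Unary.Unique.Propositional using (Unique)
  import Data.List.Relation.Unary.Unique.Propositional.Properties as Unique
  open import Data.List.Relation.Binary.Disjoint.Propositional using (Disjoint)
  open import Data.Product using (_,_; proj₁; proj₂)
  import Data.Product as Product
  open import Data.Sum using (_⊎_; inj₁; inj₂; [_,_]′)
  open import Data.Empty using (⊥; ⊥-elim)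
  open import Function using (case_of_)
  open import Function.Bundles using (mk⇔)
  open import Relation.Nullary using (¬_; Dec; yes; no)
  open import Relation.Binary.Definitions using (Tri; tri<; tri≈; tri>)
  open import Relation.Binary.PropositionalEquality
    using (_≢_; refl; sym; trans; cong; cong₂; subst; module ≡-Reasoning)
  open ConcatUpTo
  open NumericalSemigroup

  q : ℕ
  q = suc n

  e : ℕ
  e = q + 3

  d : ℕ
  d = suc e

  μ : ℕ
  μ = q * d + 2

  γ : ℕ
  γ = q * e + q * d

  t : ℕ
  t = q * 2 * μ

  generators : List ℕ
  generators = μ ∷ γ ∷ suc γ ∷ []

  S : NSet
  S = ⟨ generators ⟩ t

  γ+d≡2μ : γ + d ≡ 2 * μ
  γ+d≡2μ = identity q
    where
      identity : ∀ q → q * (q + 3) + q * suc (q + 3) + suc (q + 3) ≡ 2 * (q * suc (q + 3) + 2)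
      identity = solve-∀

  Sp≡S : Sp (q * 2) ≡ S
  Sp≡S = cong₂ (λ m g → ⟨ m ∷ g ∷ suc g ∷ [] ⟩ (q * 2 * m)) μ≡ γ≡
    where
      open ≡-Reasoning
      half : q * 2 / 2 ≡ q
      half = m*n/n≡m q 2
      μ≡ : Defs.μ (q * 2) ≡ μ
      μ≡ = trans (cong (λ h → h * h + 2 * (q * 2) + 2) half) (identity q)
        where
          identity : ∀ q → q * q + 2 * (q * 2) + 2 ≡ q * suc (q + 3) + 2
          identity = solve-∀
      γ≡ : Defs.γ (q * 2) ≡ γ
      γ≡ = begin
        2 * Defs.μ (q * 2) ∸ (q * 2 / 2 + 4)  ≡⟨ cong₂ (λ m h → 2 * m ∸ (h + 4)) μ≡ half ⟩
        2 * μ ∸ (q + 4)                        ≡⟨ cong₂ _∸_ (sym γ+d≡2μ) (+-suc q 3) ⟩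
        γ + d ∸ d                              ≡⟨ m+n∸n≡m γ d ⟩
        γ                                      ∎

  t-cubic : t ≡ q * (4 + q * (8 + q * 2))
  t-cubic = identity q
    where
      identity : ∀ q → q * 2 * (q * suc (q + 3) + 2) ≡ q * (4 + q * (8 + q * 2))
      identity = solve-∀

  μ<γ : μ < γ
  μ<γ = subst (suc μ ≤_) (identity n) (m≤m+n (suc μ) (n * n + 5 * n + 1))
    where
      identity : ∀ n → suc (suc n * suc (suc n + 3) + 2) + (n * n + 5 * n + 1)
                     ≡ suc n * (suc n + 3) + suc n * suc (suc n + 3)
      identity = solve-∀

  1+γ<2μ : suc γ < 2 * μ
  1+γ<2μ = subst (suc γ <_) (trans (sym (+-suc γ e)) γ+d≡2μ) (s<s (m<m+n γ z<s))

  2μ≤t : 2 * μ ≤ t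
  2μ≤t = *-monoˡ-≤ μ (m≤m+n 2 (n * 2))

  q<d : q < d
  q<d = s≤s (m≤m+n q 3)

  kd<μ : ∀ {k} → k ≤ q → k * d < μ
  kd<μ k≤q = ≤-<-trans (*-monoˡ-≤ d k≤q) (m<m+n (q * d) z<s)

  kd≤Mμ : ∀ {k M} → k * 2 ≤ M → k * d ≤ M * μ
  kd≤Mμ {k} {M} k2≤M = begin
    k * d         ≤⟨ *-monoʳ-≤ k (subst (d ≤_) γ+d≡2μ (m≤n+m d γ)) ⟩
    k * (2 * μ)   ≡⟨ *-assoc k 2 μ ⟨
    k * 2 * μ     ≤⟨ *-monoˡ-≤ μ k2≤M ⟩
    M * μ         ∎
    where open ≤-Reasoning

  μ≤generator : ∀ {a} → a ∈ generators → μ ≤ a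
  μ≤generator (here refl)                 = ≤-refl
  μ≤generator (there (here refl))         = <⇒≤ μ<γ
  μ≤generator (there (there (here refl))) = m≤n⇒m≤1+n (<⇒≤ μ<γ)

  generator<2μ : ∀ {a} → a ∈ generators → a < 2 * μ
  generator<2μ (here refl)                 = m<m+n μ z<s
  generator<2μ (there (here refl))         = <-trans (n<1+n γ) 1+γ<2μ
  generator<2μ (there (there (here refl))) = 1+γ<2μ

  generator<t : ∀ {a} → a ∈ generators → a < t
  generator<t a∈ = <-≤-trans (generator<2μ a∈) 2μ≤t

  open MinimalGenerators {generators} {t} {μ} (here refl) z<s μ≤generator generator<2μ generator<t

  record InSegment (M k x : ℕ) : Set where
    constructor inSegment
    field
      offset  : ℕ
      offset≤ : offset ≤ k
      shifted : x + k * d ≡ M * μ + offset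

  combination-shift : ∀ a b c → a * μ + (b * γ + (c * suc γ + 0)) + (b + c) * d
                                ≡ (a + (b + c) * 2) * μ + c
  combination-shift a b c = begin
    a * μ + (b * γ + (c * suc γ + 0)) + (b + c) * d  ≡⟨ collect a b c μ γ d ⟩
    a * μ + (b + c) * (γ + d) + c                    ≡⟨ cong (λ z → a * μ + (b + c) * z + c) γ+d≡2μ ⟩
    a * μ + (b + c) * (2 * μ) + c                    ≡⟨ regroup a (b + c) μ c ⟩
    (a + (b + c) * 2) * μ + c                        ∎
    where
      open ≡-Reasoning
      collect : ∀ a b c m g d → a * m + (b * g + (c * suc g + 0)) + (b + c) * d ≡ a * m + (b + c) * (g + d) + c
      collect = solve-∀
      regroup : ∀ a k m c → a * m + k * (2 * m) + c ≡ (a + k * 2) * m + c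
      regroup = solve-∀

  combo⇒segment : ∀ {x} → Combo generators x →
                  Σ ℕ λ M → Σ ℕ λ k → k * 2 ≤ M × k * γ ≤ x × InSegment M k x
  combo⇒segment (a , _ , (b , _ , (c , _ , refl , refl) , refl) , refl) =
    a + (b + c) * 2 , b + c , m≤n+m _ a , kγ≤x , inSegment c (m≤n+m c b) (combination-shift a b c)
    where
      open ≤-Reasoning
      kγ≤x : (b + c) * γ ≤ a * μ + (b * γ + (c * suc γ + 0))
      kγ≤x = begin
        (b + c) * γ              ≡⟨ *-distribʳ-+ γ b c ⟩
        b * γ + c * γ            ≤⟨ +-monoʳ-≤ (b * γ) (≤-trans (*-monoʳ-≤ c (n≤1+n γ)) (m≤m+n _ 0)) ⟩
        b * γ + (c * suc γ + 0)  ≤⟨ m≤n+m _ (a * μ) ⟩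
        a * μ + (b * γ + (c * suc γ + 0)) ∎

  segment⇒combo : ∀ {M k x} → k * 2 ≤ M → InSegment M k x → Combo generators x
  segment⇒combo {M} {k} {x} k2≤M (inSegment j j≤k x+kd≡) =
    a , _ , (b , _ , (j , 0 , refl , refl) , refl) , +-cancelʳ-≡ (k * d) x w (begin
      x + k * d                  ≡⟨ x+kd≡ ⟩
      M * μ + j                  ≡⟨ cong (λ z → z * μ + j) (m∸n+n≡m k2≤M) ⟨
      (a + k * 2) * μ + j        ≡⟨ cong (λ z → (a + z * 2) * μ + j) k≡b+j ⟩
      (a + (b + j) * 2) * μ + j  ≡⟨ combination-shift a b j ⟨
      w + (b + j) * d            ≡⟨ cong (λ z → w + z * d) k≡b+j ⟨
      w + k * d                  ∎)
    where
      open ≡-Reasoning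
      a = M ∸ k * 2
      b = k ∸ j
      w = a * μ + (b * γ + (j * suc γ + 0))
      k≡b+j : k ≡ b + j
      k≡b+j = sym (m∸n+n≡m j≤k)

  segment≤Mμ : ∀ {M k x} → InSegment M k x → x ≤ M * μ
  segment≤Mμ {M} {k} {x} (inSegment j j≤k eq) = +-cancelʳ-≤ (k * d) x (M * μ) (begin
    x + k * d       ≡⟨ eq ⟩
    M * μ + j       ≤⟨ +-monoʳ-≤ (M * μ) (≤-trans j≤k (m≤m*n k d)) ⟩
    M * μ + k * d   ∎)
    where open ≤-Reasoning

  Mμ<segment+μ : ∀ {M k x} → k ≤ q → InSegment M k x → M * μ < x + μ
  Mμ<segment+μ {M} {k} {x} k≤q (inSegment j _ eq) = begin-strict
    M * μ      ≤⟨ m≤m+n (M * μ) j ⟩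
    M * μ + j  ≡⟨ eq ⟨
    x + k * d  <⟨ +-monoʳ-< x (kd<μ k≤q) ⟩
    x + μ      ∎
    where open ≤-Reasoning

  2+segment≤Mμ : ∀ {M k x} → 1 ≤ k → InSegment M k x → 2 + x ≤ M * μ
  2+segment≤Mμ {M} {suc k} {x} _ (inSegment j j≤k eq) = +-cancelʳ-≤ (suc k) (2 + x) (M * μ) (begin
    2 + x + suc k       ≡⟨ shuffle x k ⟩
    x + (3 + k)         ≤⟨ +-monoʳ-≤ x (+-mono-≤ 3≤d (m≤m*n k d)) ⟩
    x + suc k * d       ≡⟨ eq ⟩
    M * μ + j           ≤⟨ +-monoʳ-≤ (M * μ) j≤k ⟩
    M * μ + suc k       ∎)
    where
      open ≤-Reasoning
      shuffle : ∀ x k → 2 + x + suc k ≡ x + (3 + k)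
      shuffle = solve-∀
      3≤d : 3 ≤ d
      3≤d = ≤-trans (m≤n+m 3 q) (n≤1+n (q + 3))

  segment-index-≤ : ∀ {M k k′ x} → k′ ≤ q → InSegment M k x → InSegment M k′ x → k′ ≤ k
  segment-index-≤ {M} {k} {k′} {x} k′≤q (inSegment j _ eq) (inSegment j′ j′≤k′ eq′) =
    ≮⇒≥ λ k<k′ → <⇒≱ (≤-<-trans k′≤q q<d) (d≤k′ k<k′)
    where
      open ≤-Reasoning
      d≤k′ : k < k′ → d ≤ k′
      d≤k′ k<k′ = +-cancelˡ-≤ (x + k * d) d k′ (begin
        x + k * d + d    ≡⟨ +-assoc x (k * d) d ⟩
        x + (k * d + d)  ≡⟨ cong (x +_) (+-comm (k * d) d) ⟩
        x + suc k * d    ≤⟨ +-monoʳ-≤ x (*-monoˡ-≤ d k<k′) ⟩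
        x + k′ * d       ≡⟨ eq′ ⟩
        M * μ + j′       ≤⟨ +-monoʳ-≤ (M * μ) j′≤k′ ⟩
        M * μ + k′       ≤⟨ +-monoˡ-≤ k′ (m≤m+n (M * μ) j) ⟩
        M * μ + j + k′   ≡⟨ cong (_+ k′) eq ⟨
        x + k * d + k′   ∎)

  window-least : ∀ {M M′ x} → x ≤ M′ * μ → M * μ < x + μ → M ≤ M′
  window-least {M} {M′} {x} x≤M′μ Mμ<x+μ = m<1+n⇒m≤n (*-cancelʳ-< μ M (suc M′) (begin-strict
    M * μ        <⟨ Mμ<x+μ ⟩
    x + μ        ≤⟨ +-monoˡ-≤ μ x≤M′μ ⟩
    M′ * μ + μ   ≡⟨ +-comm (M′ * μ) μ ⟩
    suc M′ * μ   ∎))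
    where open ≤-Reasoning

  [1+q]γ≡t+qe : suc q * γ ≡ t + q * e
  [1+q]γ≡t+qe = identity q
    where
      identity : ∀ q → suc q * (q * (q + 3) + q * suc (q + 3)) ≡ q * 2 * (q * suc (q + 3) + 2) + q * (q + 3)
      identity = solve-∀

  t<[1+q]γ : t < suc q * γ
  t<[1+q]γ = subst (t <_) (sym [1+q]γ≡t+qe) (m<m+n t z<s)

  segment : ℕ → ℕ → List ℕ
  segment M k = applyUpTo (M * μ ∸ k * d +_) (suc k)

  segment-offset : ∀ {M k} j → k * d ≤ M * μ → M * μ ∸ k * d + j + k * d ≡ M * μ + j
  segment-offset {M} {k} j kd≤Mμ = begin
    M * μ ∸ k * d + j + k * d  ≡⟨ xy∙z≈xz∙y (M * μ ∸ k * d) j (k * d) ⟩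
    M * μ ∸ k * d + k * d + j  ≡⟨ cong (_+ j) (m∸n+n≡m kd≤Mμ) ⟩
    M * μ + j                  ∎
    where open ≡-Reasoning

  ∈-segment⁺ : ∀ {M k x} → k * d ≤ M * μ → InSegment M k x → x ∈ segment M k
  ∈-segment⁺ {M} {k} {x} kd≤Mμ (inSegment j j≤k eq) =
    subst (_∈ segment M k) (+-cancelʳ-≡ (k * d) _ x (trans (segment-offset {M} {k} j kd≤Mμ) (sym eq)))
          (∈-applyUpTo⁺ (M * μ ∸ k * d +_) (s≤s j≤k))

  ∈-segment⁻ : ∀ {M k x} → k * d ≤ M * μ → x ∈ segment M k → InSegment M k x
  ∈-segment⁻ {M} {k} kd≤Mμ x∈ with ∈-applyUpTo⁻ (M * μ ∸ k * d +_) x∈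
  ... | j , j<1+k , refl = inSegment j (m<1+n⇒m≤n j<1+k) (segment-offset {M} {k} j kd≤Mμ)

  segment-unique : ∀ M k → Unique (segment M k)
  segment-unique M k = shiftedUpTo-unique (M * μ ∸ k * d) (suc k)

  lowerSegments : ℕ → ℕ → List ℕ
  lowerSegments M K = concatUpTo (λ i → segment M (suc i)) K

  ∈-lowerSegments⁺ : ∀ {M K k x} → K * 2 ≤ M → 1 ≤ k → k ≤ K → InSegment M k x →
                     x ∈ lowerSegments M K
  ∈-lowerSegments⁺ {M} {K} {suc i} K2≤M _ k≤K x∈ =
    ∈-concatUpTo⁺ {f = λ i → segment M (suc i)} k≤K
      (∈-segment⁺ (kd≤Mμ {suc i} (≤-trans (*-monoˡ-≤ 2 k≤K) K2≤M)) x∈)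

  ∈-lowerSegments⁻ : ∀ {M K x} → K * 2 ≤ M → x ∈ lowerSegments M K →
                     Σ ℕ λ k → 1 ≤ k × k ≤ K × InSegment M k x
  ∈-lowerSegments⁻ {M} {K} K2≤M x∈ with ∈-concatUpTo⁻ {f = λ i → segment M (suc i)} {K} x∈
  ... | i , i<K , x∈i =
    suc i , s≤s z≤n , i<K , ∈-segment⁻ (kd≤Mμ {suc i} (≤-trans (*-monoˡ-≤ 2 i<K) K2≤M)) x∈i

  lowerSegments-unique : ∀ {M K} → K ≤ q → K * 2 ≤ M → Unique (lowerSegments M K)
  lowerSegments-unique {M} {K} K≤q K2≤M = concatUpTo-unique (λ _ → segment-unique M _) disjoint
    where
      jd≤Mμ : ∀ {j} → j < K → suc j * d ≤ M * μ
      jd≤Mμ {j} j<K = kd≤Mμ {suc j} (≤-trans (*-monoˡ-≤ 2 j<K) K2≤M)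
      disjoint : ∀ {i j} → i < j → j < K → Disjoint (segment M (suc i)) (segment M (suc j))
      disjoint i<j j<K (x∈i , x∈j) = <⇒≱ (s<s i<j)
        (segment-index-≤ {M} (≤-trans j<K K≤q) (∈-segment⁻ {M} (jd≤Mμ (<-trans i<j j<K)) x∈i)
                                               (∈-segment⁻ {M} (jd≤Mμ j<K) x∈j))

  block : ℕ → ℕ → List ℕ
  block M K = M * μ ∷ lowerSegments M K

  ∈-block⁺ : ∀ {M K k x} → K * 2 ≤ M → k ≤ K → InSegment M k x → x ∈ block M K
  ∈-block⁺ {M} {k = zero}  {x} _ _ (inSegment zero _ eq) = here (+-cancelʳ-≡ 0 x (M * μ) eq)
  ∈-block⁺ {k = suc k} K2≤M k≤K x∈ = there (∈-lowerSegments⁺ K2≤M (s≤s z≤n) k≤K x∈)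

  ∈-block⁻ : ∀ {M K x} → K * 2 ≤ M → x ∈ block M K → Σ ℕ λ k → k ≤ K × InSegment M k x
  ∈-block⁻ _ (here refl) = 0 , z≤n , inSegment 0 z≤n refl
  ∈-block⁻ K2≤M (there x∈) = case ∈-lowerSegments⁻ K2≤M x∈ of λ where
    (k , _ , k≤K , x∈k) → k , k≤K , x∈k

  block-unique : ∀ {M K} → K ≤ q → K * 2 ≤ M → Unique (block M K)
  block-unique {M} {K} K≤q K2≤M = All.tabulate top∉lowerSegments ∷ lowerSegments-unique K≤q K2≤M
    where
      top∉lowerSegments : ∀ {x} → x ∈ lowerSegments M K → M * μ ≢ x
      top∉lowerSegments x∈ refl = case ∈-lowerSegments⁻ {M} {K} K2≤M x∈ of λ where
        (_ , 1≤k , _ , x∈k) → <⇒≱ (2+segment≤Mμ 1≤k x∈k) (n≤1+n _)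

  ≤-half : ∀ {k M} → k * 2 ≤ M → k ≤ M / 2
  ≤-half {k} {M} k2≤M = subst (_≤ M / 2) (m*n/n≡m k 2) (/-monoˡ-≤ 2 k2≤M)

  blocksBelow : ℕ → List ℕ
  blocksBelow m = concatUpTo (λ M → block M (M / 2)) m

  ∈-blocksBelow⁺ : ∀ {m M k x} → M < m → k * 2 ≤ M → InSegment M k x → x ∈ blocksBelow m
  ∈-blocksBelow⁺ {M = M} M<m k2≤M x∈ =
    ∈-concatUpTo⁺ M<m (∈-block⁺ {M} {M / 2} (m/n*n≤m M 2) (≤-half k2≤M) x∈)

  ∈-blocksBelow⁻ : ∀ {m x} → x ∈ blocksBelow m →
                   Σ ℕ λ M → Σ ℕ λ k → M < m × k * 2 ≤ M × InSegment M k x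
  ∈-blocksBelow⁻ x∈ with ∈-concatUpTo⁻ x∈
  ... | M , M<m , x∈M with ∈-block⁻ {M} {M / 2} (m/n*n≤m M 2) x∈M
  ...   | k , k≤M/2 , x∈k = M , k , M<m , ≤-trans (*-monoˡ-≤ 2 k≤M/2) (m/n*n≤m M 2) , x∈k

  blocksBelow-unique : ∀ {m} → m ≤ q * 2 → Unique (blocksBelow m)
  blocksBelow-unique {m} m≤2q =
    concatUpTo-unique (λ {M} M<m → block-unique {M} {M / 2} (half≤q M<m) (m/n*n≤m M 2)) disjoint
    where
      half≤q : ∀ {M} → M < m → M / 2 ≤ q
      half≤q {M} M<m = subst (M / 2 ≤_) (m*n/n≡m q 2) (/-monoˡ-≤ 2 (<⇒≤ (<-≤-trans M<m m≤2q)))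
      disjoint : ∀ {M M′} → M < M′ → M′ < m → Disjoint (block M (M / 2)) (block M′ (M′ / 2))
      disjoint {M} {M′} M<M′ M′<m (x∈M , x∈M′) =
        case ∈-block⁻ {M} {M / 2} (m/n*n≤m M 2) x∈M , ∈-block⁻ {M′} {M′ / 2} (m/n*n≤m M′ 2) x∈M′ of λ where
          ((_ , _ , x∈k) , (_ , k′≤ , x∈k′)) →
            <⇒≱ M<M′ (window-least {M′} {M} (segment≤Mμ {M} x∈k)
                                            (Mμ<segment+μ {M′} (≤-trans k′≤ (half≤q M′<m)) x∈k′))

  smallElements : List ℕ
  smallElements = blocksBelow (q * 2) ++ lowerSegments (q * 2) q

  ∈-smallElements⁻ : ∀ {x} → x ∈ smallElements → Combo generators x × 2 + x ≤ t
  ∈-smallElements⁻ {x} x∈ = [ fromBlocksBelow , fromLowerSegments ]′ (∈-++⁻ (blocksBelow (q * 2)) x∈)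
    where
      open ≤-Reasoning
      fromBlocksBelow : x ∈ blocksBelow (q * 2) → Combo generators x × 2 + x ≤ t
      fromBlocksBelow x∈blocks = case ∈-blocksBelow⁻ {q * 2} x∈blocks of λ where
        (M , _ , M<2q , k2≤M , x∈k) → segment⇒combo k2≤M x∈k , (begin
          2 + x      ≤⟨ +-monoʳ-≤ 2 (segment≤Mμ x∈k) ⟩
          2 + M * μ  ≤⟨ +-monoˡ-≤ (M * μ) (m≤n+m 2 (q * d)) ⟩
          suc M * μ  ≤⟨ *-monoˡ-≤ μ M<2q ⟩
          t          ∎)
      fromLowerSegments : x ∈ lowerSegments (q * 2) q → Combo generators x × 2 + x ≤ t
      fromLowerSegments x∈segments = case ∈-lowerSegments⁻ {q * 2} {q} ≤-refl x∈segments of λ where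
        (_ , 1≤k , k≤q , x∈k) → segment⇒combo (*-monoˡ-≤ 2 k≤q) x∈k , 2+segment≤Mμ 1≤k x∈k

  ∈-smallElements⁺ : ∀ {x} → Combo generators x → x < t → x ∈ smallElements
  ∈-smallElements⁺ {x} cx x<t with combo⇒segment cx
  ... | M , k , k2≤M , kγ≤x , x∈k =
    place k2≤M k≤q x∈k (m≤n⇒m<n∨m≡n (window-least (<⇒≤ x<t) (Mμ<segment+μ k≤q x∈k)))
    where
      k≤q : k ≤ q
      k≤q = m<1+n⇒m≤n (*-cancelʳ-< γ k (suc q) (≤-<-trans kγ≤x (<-trans x<t t<[1+q]γ)))
      place : ∀ {M k} → k * 2 ≤ M → k ≤ q → InSegment M k x → M < q * 2 ⊎ M ≡ q * 2 → x ∈ smallElements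
      place k2≤M _ x∈k (inj₁ M<2q) = ∈-++⁺ˡ (∈-blocksBelow⁺ {q * 2} M<2q k2≤M x∈k)
      place {k = zero} _ _ (inSegment zero z≤n eq) (inj₂ refl) = ⊥-elim (<⇒≢ x<t (+-cancelʳ-≡ 0 x t eq))
      place {k = suc k} _ k≤q x∈k (inj₂ refl) =
        ∈-++⁺ʳ (blocksBelow (q * 2)) (∈-lowerSegments⁺ {q * 2} {q} ≤-refl (s≤s z≤n) k≤q x∈k)

  smallElements-unique : Unique smallElements
  smallElements-unique =
    Unique.++⁺ (blocksBelow-unique {q * 2} ≤-refl) (lowerSegments-unique {q * 2} {q} ≤-refl ≤-refl) disjoint
    where
      disjoint : Disjoint (blocksBelow (q * 2)) (lowerSegments (q * 2) q)
      disjoint (x∈blocks , x∈segments) =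
        case ∈-blocksBelow⁻ {q * 2} x∈blocks , ∈-lowerSegments⁻ {q * 2} {q} ≤-refl x∈segments of λ where
          ((_ , _ , M<2q , _ , x∈k) , (_ , _ , k′≤q , x∈k′)) →
            <⇒≱ M<2q (window-least (segment≤Mμ x∈k) (Mμ<segment+μ k′≤q x∈k′))

  smallElements-enumerate : Enumerates (SmallElem S t) smallElements
  smallElements-enumerate = smallElements-unique , λ x → mk⇔ (to x) (from x)
    where
      to : ∀ x → x ∈ smallElements → SmallElem S t x
      to x x∈ = Product.map inj₁ (≤-trans (n≤1+n (suc x))) (∈-smallElements⁻ x∈)
      from : ∀ x → SmallElem S t x → x ∈ smallElements
      from x (inj₁ cx , x<t)  = ∈-smallElements⁺ cx x<t
      from x (inj₂ t≤x , x<t) = ⊥-elim (<⇒≱ x<t t≤x)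

  -- t reduces to a successor, so suc (pred t) is t itself.
  conductor : IsConductor S t
  conductor = isConductor-suc {c = pred t} (λ _ → inj₂) t-1∉S
    where
      t-1∉S : ¬ S (pred t)
      t-1∉S (inj₁ c)  = 1+n≰n (proj₂ (∈-smallElements⁻ (∈-smallElements⁺ c (n<1+n (pred t)))))
      t-1∉S (inj₂ t≤) = <⇒≱ (n<1+n (pred t)) t≤

  record IsGap (s : ℕ) : Set where
    constructor gap
    field
      positive : 1 ≤ s
      row      : ℕ
      column   : ℕ
      row<q    : row < q
      column≤  : column ≤ suc row
      position : s ≡ row * e + column

  [1+q]e≡1+μ : suc q * e ≡ suc μ
  [1+q]e≡1+μ = identity q
    where
      identity : ∀ q → suc q * (q + 3) ≡ suc (q * suc (q + 3) + 2)
      identity = solve-∀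

  gap-bound : ∀ {s} → IsGap s → s + d < μ
  gap-bound (gap _ i u i<q u≤ refl) = begin-strict
    i * e + u + d          ≤⟨ +-monoˡ-≤ d (+-monoʳ-≤ (i * e) u≤) ⟩
    i * e + suc i + d      ≡⟨ identity i e ⟩
    suc (suc i * suc e)    ≤⟨ s≤s (*-monoˡ-≤ d i<q) ⟩
    suc (q * d)            ≡⟨ +-comm 1 (q * d) ⟩
    q * d + 1              <⟨ +-monoʳ-< (q * d) (n<1+n 1) ⟩
    μ                      ∎
    where
      open ≤-Reasoning
      identity : ∀ i e → i * e + suc i + suc e ≡ suc (suc i * suc e)
      identity = solve-∀

  gap-avoids-segment : ∀ {s j k} → IsGap s → j ≤ k → s + k * d ≢ μ + j
  gap-avoids-segment {j = j} {k} (gap _ i u i<q u≤ refl) j≤k eq = avoid (i + k ≤? q)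
    where
      open ≤-Reasoning
      -- As ie = id − i, the equation says (i + k)d + u = μ + j + i: too small if i + k ≤ q, too large otherwise.
      shifted : (i + k) * d + u ≡ μ + j + i
      shifted = trans (sym (identity i u k e)) (cong (_+ i) eq)
        where
          identity : ∀ i u k e → i * e + u + k * suc e + i ≡ (i + k) * suc e + u
          identity = solve-∀
      avoid : Dec (i + k ≤ q) → ⊥
      avoid (yes i+k≤q) = <-irrefl shifted (begin-strict
        (i + k) * d + u      ≤⟨ +-mono-≤ (*-monoˡ-≤ d i+k≤q) u≤ ⟩
        q * d + suc i        <⟨ +-monoʳ-< (q * d) (s≤s (s≤s (m≤n+m i j))) ⟩
        q * d + (2 + j + i)  ≡⟨ regroup (q * d) j i ⟩
        μ + j + i            ∎)
        where
          regroup : ∀ a j i → a + (2 + j + i) ≡ a + 2 + j + i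
          regroup = solve-∀
      avoid (no i+k≰q) = <-irrefl (sym shifted) (begin-strict
        μ + j + i              ≤⟨ +-monoˡ-≤ i (+-monoʳ-≤ μ j≤k) ⟩
        μ + k + i              ≡⟨ xy∙z≈x∙zy μ k i ⟩
        μ + (i + k)            <⟨ +-monoˡ-< (i + k) (n<1+n μ) ⟩
        suc μ + (i + k)        ≡⟨ cong (_+ (i + k)) [1+q]e≡1+μ ⟨
        suc q * e + (i + k)    ≤⟨ +-monoˡ-≤ (i + k) (*-monoˡ-≤ e (≰⇒> i+k≰q)) ⟩
        (i + k) * e + (i + k)  ≡⟨ +-comm ((i + k) * e) (i + k) ⟩
        (i + k) + (i + k) * e  ≡⟨ *-suc (i + k) e ⟨
        (i + k) * d            ≤⟨ m≤m+n _ u ⟩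
        (i + k) * d + u        ∎)

  t+μ<[2+q]γ : t + μ < suc (suc q) * γ
  t+μ<[2+q]γ = begin-strict
    t + μ               <⟨ +-mono-≤-< (m≤m+n t (q * e)) μ<γ ⟩
    t + q * e + γ       ≡⟨ cong (_+ γ) [1+q]γ≡t+qe ⟨
    suc q * γ + γ       ≡⟨ +-comm (suc q * γ) γ ⟩
    suc (suc q) * γ     ∎
    where open ≤-Reasoning

  gap⇒¬combo : ∀ {s} → IsGap s → ¬ Combo generators (t + s)
  gap⇒¬combo {s} g@(gap 1≤s _ _ _ _ _) c with combo⇒segment c
  ... | M , k , _ , kγ≤t+s , inSegment j j≤k eq = gap-avoids-segment g j≤k s+kd≡μ+j
    where
      -- The window of t + s is p + 1: t < Mμ because s > 0, and Mμ < t + 2μ because k ≤ q + 1.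
      k≤1+q : k ≤ suc q
      k≤1+q = m<1+n⇒m≤n (*-cancelʳ-< γ k (suc (suc q))
                (≤-<-trans kγ≤t+s (<-trans (+-monoʳ-< t (<-trans (m<m+n s z<s) (gap-bound g))) t+μ<[2+q]γ)))
      t+j<Mμ+j : t + j < M * μ + j
      t+j<Mμ+j = begin-strict
        t + j              <⟨ +-monoʳ-< t (≤-<-trans (≤-trans j≤k (m≤m*n k d)) (m<n+m (k * d) 1≤s)) ⟩
        t + (s + k * d)    ≡⟨ +-assoc t s (k * d) ⟨
        t + s + k * d      ≡⟨ eq ⟩
        M * μ + j          ∎
        where open ≤-Reasoning
      Mμ<[2+2q]μ : M * μ < suc (suc (q * 2)) * μ
      Mμ<[2+2q]μ = begin-strict
        M * μ                  ≤⟨ m≤m+n (M * μ) j ⟩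
        M * μ + j              ≡⟨ eq ⟨
        t + s + k * d          ≤⟨ +-monoʳ-≤ (t + s) (*-monoˡ-≤ d k≤1+q) ⟩
        t + s + (d + q * d)    ≡⟨ regroup t s d (q * d) ⟩
        t + (s + d) + q * d    <⟨ +-monoˡ-< (q * d) (+-monoʳ-< t (gap-bound g)) ⟩
        t + μ + q * d          <⟨ +-monoʳ-< (t + μ) (m<m+n (q * d) z<s) ⟩
        t + μ + μ              ≡⟨ regroup′ t μ ⟩
        suc (suc (q * 2)) * μ  ∎
        where
          open ≤-Reasoning
          regroup : ∀ t s d a → t + s + (d + a) ≡ t + (s + d) + a
          regroup = solve-∀
          regroup′ : ∀ t m → t + m + m ≡ m + (m + t)
          regroup′ = solve-∀
      M≡1+2q : M ≡ suc (q * 2)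
      M≡1+2q = ≤-antisym (m<1+n⇒m≤n (*-cancelʳ-< μ M _ Mμ<[2+2q]μ))
                         (*-cancelʳ-< μ (q * 2) M (+-cancelʳ-< j t (M * μ) t+j<Mμ+j))
      s+kd≡μ+j : s + k * d ≡ μ + j
      s+kd≡μ+j = +-cancelˡ-≡ t _ _ (begin
        t + (s + k * d)  ≡⟨ +-assoc t s (k * d) ⟨
        t + s + k * d    ≡⟨ eq ⟩
        M * μ + j        ≡⟨ cong (λ M → M * μ + j) M≡1+2q ⟩
        μ + t + j        ≡⟨ xy∙z≈y∙xz μ t j ⟩
        t + (μ + j)      ∎)
        where open ≡-Reasoning

  gap-or-combo : ∀ {s} → s < μ → IsGap s ⊎ Combo generators (t + s)
  gap-or-combo {zero} _ = inj₂ (segment⇒combo {q * 2} {0} z≤n (inSegment 0 z≤n (cong (_+ 0) (+-identityʳ t))))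
  gap-or-combo {s@(suc _)} s<μ = classify (<-cmp i q)
    where
      i = s / e
      u = s % e
      s≡u+ie : s ≡ u + i * e
      s≡u+ie = m≡m%n+[m/n]*n s e
      s≡ie+u : s ≡ i * e + u
      s≡ie+u = trans s≡u+ie (+-comm u (i * e))
      -- If i < q and u > i + 1 then t + s lies in segment q − i of window p + 1; if i = q, in segment
      -- q + 1 of window p + 2.
      classify : Tri (i < q) (i ≡ q) (i > q) → IsGap s ⊎ Combo generators (t + s)
      classify (tri< i<q _ _) with u ≤? suc i
      ... | yes u≤1+i = inj₁ (gap (s≤s z≤n) i u i<q u≤1+i s≡ie+u)
      ... | no  u≰1+i = inj₂ (segment⇒combo {suc (q * 2)} {q ∸ i} r2≤ (inSegment c c≤r shifted))
        where
          r = q ∸ i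
          c = u ∸ (2 + i)
          i+r≡q : i + r ≡ q
          i+r≡q = m+[n∸m]≡n (<⇒≤ i<q)
          2+i+c≡u : 2 + i + c ≡ u
          2+i+c≡u = m+[n∸m]≡n (≰⇒> u≰1+i)
          r2≤ : r * 2 ≤ suc (q * 2)
          r2≤ = ≤-trans (*-monoˡ-≤ 2 (m∸n≤m q i)) (n≤1+n (q * 2))
          c≤r : c ≤ r
          c≤r = +-cancelˡ-≤ (2 + i) c r (≤-pred (begin-strict
            2 + i + c   ≡⟨ 2+i+c≡u ⟩
            u           <⟨ m%n<n s e ⟩
            q + 3       ≡⟨ cong (_+ 3) i+r≡q ⟨
            i + r + 3   ≡⟨ regroup i r ⟩
            suc (2 + i + r) ∎))
            where
              open ≤-Reasoning
              regroup : ∀ i r → i + r + 3 ≡ suc (2 + i + r)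
              regroup = solve-∀
          s≡2+i+c+ie : s ≡ 2 + i + c + i * e
          s≡2+i+c+ie = trans s≡u+ie (cong (_+ i * e) (sym 2+i+c≡u))
          shifted : t + s + r * d ≡ suc (q * 2) * μ + c
          shifted = begin
            t + s + r * d                   ≡⟨ cong (λ z → t + z + r * d) s≡2+i+c+ie ⟩
            t + (2 + i + c + i * e) + r * d ≡⟨ regroup t c i e r ⟩
            t + c + ((i + r) * d + 2)       ≡⟨ cong (λ z → t + c + (z * d + 2)) i+r≡q ⟩
            t + c + μ                       ≡⟨ regroup′ t c μ ⟩
            suc (q * 2) * μ + c             ∎
            where
              open ≡-Reasoning
              regroup : ∀ t c i e r → t + (2 + i + c + i * e) + r * suc e ≡ t + c + ((i + r) * suc e + 2)
              regroup = solve-∀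
              regroup′ : ∀ t c m → t + c + m ≡ m + t + c
              regroup′ = solve-∀
      classify (tri≈ _ i≡q _) = inj₂ (segment⇒combo {2 + q * 2} {suc q} ≤-refl (inSegment u u≤1+q shifted))
        where
          s≡u+qe : s ≡ u + q * e
          s≡u+qe = trans s≡u+ie (cong (λ z → u + z * e) i≡q)
          u≤1+q : u ≤ suc q
          u≤1+q = m<1+n⇒m≤n (+-cancelʳ-< (q * e) u (2 + q) (begin-strict
            u + q * e      ≡⟨ s≡u+qe ⟨
            s              <⟨ s<μ ⟩
            μ              ≡⟨ identity q ⟩
            2 + q + q * e  ∎))
            where
              open ≤-Reasoning
              identity : ∀ q → q * suc (q + 3) + 2 ≡ 2 + q + q * (q + 3)
              identity = solve-∀
          shifted : t + s + suc q * d ≡ (2 + q * 2) * μ + u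
          shifted = begin
            t + s + suc q * d          ≡⟨ cong (λ z → t + z + suc q * d) s≡u+qe ⟩
            t + (u + q * e) + suc q * d ≡⟨ regroup t u q e ⟩
            t + u + (γ + d)            ≡⟨ cong (t + u +_) γ+d≡2μ ⟩
            t + u + 2 * μ              ≡⟨ regroup′ t u μ ⟩
            (2 + q * 2) * μ + u        ∎
            where
              open ≡-Reasoning
              regroup : ∀ t u q e → t + (u + q * e) + suc q * suc e ≡ t + u + (q * e + q * suc e + suc e)
              regroup = solve-∀
              regroup′ : ∀ t u m → t + u + 2 * m ≡ m + (m + t) + u
              regroup′ = solve-∀
      classify (tri> _ _ q<i) = ⊥-elim (<⇒≱ s<μ (begin
        μ              ≤⟨ n≤1+n μ ⟩
        suc μ          ≡⟨ [1+q]e≡1+μ ⟨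
        suc q * e      ≤⟨ *-monoˡ-≤ e q<i ⟩
        i * e          ≤⟨ m≤n+m (i * e) u ⟩
        u + i * e      ≡⟨ s≡u+ie ⟨
        s              ∎))
        where open ≤-Reasoning

  1+q≤e : suc q ≤ e
  1+q≤e = subst (_≤ e) (+-comm q 1) (+-monoʳ-≤ q (s≤s z≤n))

  gapInterval : ℕ → List ℕ
  gapInterval i = applyUpTo (t + i * e +_) (2 + i)

  gaps : List ℕ
  gaps = t + 1 ∷ concatUpTo (λ i → gapInterval (suc i)) n

  ∈-gaps⁺ : ∀ {s} → IsGap s → t + s ∈ gaps
  ∈-gaps⁺ (gap _ zero (suc zero) _ _ refl) = here refl
  ∈-gaps⁺ (gap () zero zero _ _ refl)
  ∈-gaps⁺ (gap _ zero (suc (suc _)) _ (s≤s ()) refl)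
  ∈-gaps⁺ (gap _ (suc i) u i<q u≤ refl) =
    there (∈-concatUpTo⁺ {f = λ i → gapInterval (suc i)} (≤-pred i<q)
             (subst (_∈ gapInterval (suc i)) (+-assoc t (suc i * e) u) (∈-applyUpTo⁺ (t + suc i * e +_) (s≤s u≤))))

  ∈-gaps⁻ : ∀ {x} → x ∈ gaps → Σ ℕ λ s → IsGap s × x ≡ t + s
  ∈-gaps⁻ (here refl) = 1 , gap (s≤s z≤n) 0 1 (s≤s z≤n) (s≤s z≤n) refl , refl
  ∈-gaps⁻ (there x∈) with ∈-concatUpTo⁻ {f = λ i → gapInterval (suc i)} {n} x∈
  ... | i , i<n , x∈i with ∈-applyUpTo⁻ (t + suc i * e +_) x∈i
  ...   | u , u<3+i , refl =
    suc i * e + u , gap (s≤s z≤n) (suc i) u (s≤s i<n) (m<1+n⇒m≤n u<3+i) refl , +-assoc t (suc i * e) u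

  gapInterval-range : ∀ {i x} → i < q → x ∈ gapInterval i → t + i * e ≤ x × x < t + suc i * e
  gapInterval-range {i} i<q x∈ with ∈-applyUpTo⁻ (t + i * e +_) x∈
  ... | u , u<2+i , refl = m≤m+n (t + i * e) u , (begin-strict
    t + i * e + u  <⟨ +-monoʳ-< (t + i * e) (<-≤-trans u<2+i (≤-trans (s≤s i<q) 1+q≤e)) ⟩
    t + i * e + e  ≡⟨ xy∙z≈x∙zy t (i * e) e ⟩
    t + (e + i * e) ∎)
    where open ≤-Reasoning

  gaps-unique : Unique gaps
  gaps-unique =
    All.tabulate t+1∉rest ∷ concatUpTo-unique (λ {i} _ → shiftedUpTo-unique (t + suc i * e) (2 + suc i)) disjoint
    where
      t+1∉rest : ∀ {x} → x ∈ concatUpTo (λ i → gapInterval (suc i)) n → t + 1 ≢ x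
      t+1∉rest x∈ refl with ∈-concatUpTo⁻ {f = λ i → gapInterval (suc i)} {n} x∈
      ... | i , i<n , x∈i = <⇒≱ (+-monoʳ-< t (≤-trans (≤-trans (s≤s (s≤s z≤n)) 1+q≤e) (m≤m+n e (i * e))))
                                (proj₁ (gapInterval-range (s<s i<n) x∈i))
      disjoint : ∀ {i j} → i < j → j < n → Disjoint (gapInterval (suc i)) (gapInterval (suc j))
      disjoint {i} {j} i<j j<n (x∈i , x∈j) =
        <⇒≱ (<-≤-trans (proj₂ (gapInterval-range (s<s (<-trans i<j j<n)) x∈i)) (+-monoʳ-≤ t (*-monoˡ-≤ e (s≤s i<j))))
            (proj₁ (gapInterval-range (s<s j<n) x∈j))

  minimalGenerators : List ℕ
  minimalGenerators = generators ++ gaps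

  generators-unique : Unique generators
  generators-unique = (<⇒≢ μ<γ ∷ <⇒≢ (m≤n⇒m≤1+n μ<γ) ∷ []) ∷ (<⇒≢ (n<1+n γ) ∷ []) ∷ [] ∷ []

  minimalGenerators-enumerate : Enumerates (MinGen S) minimalGenerators
  minimalGenerators-enumerate = Unique.++⁺ generators-unique gaps-unique disjoint , λ x → mk⇔ to from
    where
      disjoint : Disjoint generators gaps
      disjoint (x∈generators , x∈gaps) with ∈-gaps⁻ x∈gaps
      ... | s , _ , refl = <⇒≱ (generator<t x∈generators) (m≤m+n t s)
      to : ∀ {x} → x ∈ minimalGenerators → MinGen S x
      to x∈ with ∈-++⁻ generators x∈
      ... | inj₁ x∈generators = minGen-∈ x∈generators
      ... | inj₂ x∈gaps with ∈-gaps⁻ x∈gaps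
      ...   | s , g , refl =
        minGen-above (m≤m+n t s) (+-monoʳ-< t (<-trans (m<m+n s z<s) (gap-bound g))) (gap⇒¬combo g)
      from : ∀ {x} → MinGen S x → x ∈ minimalGenerators
      from mg with minGen-cases mg
      ... | inj₁ x∈generators = ∈-++⁺ˡ x∈generators
      ... | inj₂ (t≤x , x<t+μ , x∉C)
        with gap-or-combo (+-cancelˡ-< t _ μ (subst (_< t + μ) (sym (m+[n∸m]≡n t≤x)) x<t+μ))
      ...   | inj₁ g = ∈-++⁺ʳ generators (subst (_∈ gaps) (m+[n∸m]≡n t≤x) (∈-gaps⁺ g))
      ...   | inj₂ c = ⊥-elim (x∉C (subst (Combo generators) (m+[n∸m]≡n t≤x) c))

  length-lowerSegments : ∀ M K → 2 * length (lowerSegments M K) ≡ K * (K + 2 * 1 + 1)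
  length-lowerSegments M = length-concatUpTo-linear 1 λ k → length-applyUpTo (M * μ ∸ suc k * d +_) (2 + k)

  length-block : ∀ M K → 2 * length (block M K) ≡ suc K * (K + 2)
  length-block M K = begin
    2 * suc (length (lowerSegments M K))  ≡⟨ *-suc 2 (length (lowerSegments M K)) ⟩
    2 + 2 * length (lowerSegments M K)    ≡⟨ cong (2 +_) (length-lowerSegments M K) ⟩
    2 + K * (K + 2 * 1 + 1)               ≡⟨ identity K ⟩
    suc K * (K + 2)                       ∎
    where
      open ≡-Reasoning
      identity : ∀ K → 2 + K * (K + 2 * 1 + 1) ≡ suc K * (K + 2)
      identity = solve-∀

  length-blocksBelow : ∀ m → 6 * length (blocksBelow (m * 2)) ≡ 2 * (m * suc m * (m + 2))
  length-blocksBelow zero    = refl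
  length-blocksBelow (suc m) = begin
    6 * length (blocksBelow (suc m * 2))             ≡⟨ cong (6 *_) length-step ⟩
    6 * (length (blocksBelow (m * 2)) + |B₀| + |B₁|) ≡⟨ regroup (length (blocksBelow (m * 2))) |B₀| |B₁| ⟩
    6 * length (blocksBelow (m * 2)) + 3 * (2 * |B₀|) + 3 * (2 * |B₁|)
      ≡⟨ cong₂ (λ a b → a + 3 * b + 3 * (2 * |B₁|)) (length-blocksBelow m) 2|B₀| ⟩
    2 * (m * suc m * (m + 2)) + 3 * (suc m * (m + 2)) + 3 * (2 * |B₁|)
      ≡⟨ cong (λ c → 2 * (m * suc m * (m + 2)) + 3 * (suc m * (m + 2)) + 3 * c) 2|B₁| ⟩
    2 * (m * suc m * (m + 2)) + 3 * (suc m * (m + 2)) + 3 * (suc m * (m + 2))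
      ≡⟨ identity m ⟩
    2 * (suc m * suc (suc m) * (suc m + 2))          ∎
    where
      open ≡-Reasoning
      f : ℕ → List ℕ
      f M = block M (M / 2)
      |B₀| = length (f (m * 2))
      |B₁| = length (f (suc (m * 2)))
      length-step : length (blocksBelow (suc m * 2)) ≡ length (blocksBelow (m * 2)) + |B₀| + |B₁|
      length-step = trans (length-concatUpTo-suc f (suc (m * 2))) (cong (_+ |B₁|) (length-concatUpTo-suc f (m * 2)))
      2|B₀| : 2 * |B₀| ≡ suc m * (m + 2)
      2|B₀| = trans (cong (λ K → 2 * length (block (m * 2) K)) (m*n/n≡m m 2)) (length-block (m * 2) m)
      [1+2m]/2≡m : suc (m * 2) / 2 ≡ m
      [1+2m]/2≡m = trans (+-distrib-/-∣ʳ 1 {m * 2} {2} (divides m refl)) (m*n/n≡m m 2)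
      2|B₁| : 2 * |B₁| ≡ suc m * (m + 2)
      2|B₁| = trans (cong (λ K → 2 * length (block (suc (m * 2)) K)) [1+2m]/2≡m) (length-block (suc (m * 2)) m)
      regroup : ∀ a b c → 6 * (a + b + c) ≡ 6 * a + 3 * (2 * b) + 3 * (2 * c)
      regroup = solve-∀
      identity : ∀ m → 2 * (m * suc m * (m + 2)) + 3 * (suc m * (m + 2)) + 3 * (suc m * (m + 2))
                     ≡ 2 * (suc m * suc (suc m) * (suc m + 2))
      identity = solve-∀

  length-smallElements : 6 * length smallElements ≡ q * (13 + q * (9 + q * 2))
  length-smallElements = begin
    6 * length (blocksBelow (q * 2) ++ lowerSegments (q * 2) q)  ≡⟨ cong (6 *_) (length-++ (blocksBelow (q * 2))) ⟩
    6 * (|B| + |S|)                                               ≡⟨ regroup |B| |S| ⟩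
    6 * |B| + 3 * (2 * |S|)                                       ≡⟨ cong₂ (λ a b → a + 3 * b) (length-blocksBelow q)
                                                                                                (length-lowerSegments (q * 2) q) ⟩
    2 * (q * suc q * (q + 2)) + 3 * (q * (q + 2 * 1 + 1))         ≡⟨ identity q ⟩
    q * (13 + q * (9 + q * 2))                                    ∎
    where
      open ≡-Reasoning
      |B| = length (blocksBelow (q * 2))
      |S| = length (lowerSegments (q * 2) q)
      regroup : ∀ a b → 6 * (a + b) ≡ 6 * a + 3 * (2 * b)
      regroup = solve-∀
      identity : ∀ q → 2 * (q * suc q * (q + 2)) + 3 * (q * (q + 2 * 1 + 1)) ≡ q * (13 + q * (9 + q * 2))
      identity = solve-∀

  length-gapIntervals : ∀ i → 2 * length (concatUpTo (λ i → gapInterval (suc i)) i) ≡ i * (i + 2 * 2 + 1)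
  length-gapIntervals = length-concatUpTo-linear 2 λ i → length-applyUpTo (t + suc i * e +_) (3 + i)

  length-minimalGenerators : 2 * length minimalGenerators ≡ 4 + q * (3 + q)
  length-minimalGenerators = begin
    2 * (4 + length (concatUpTo (λ i → gapInterval (suc i)) n))       ≡⟨ *-distribˡ-+ 2 4 _ ⟩
    8 + 2 * length (concatUpTo (λ i → gapInterval (suc i)) n)         ≡⟨ cong (8 +_) (length-gapIntervals n) ⟩
    8 + n * (n + 2 * 2 + 1)                                            ≡⟨ identity n ⟩
    4 + q * (3 + q)                                                    ∎
    where
      open ≡-Reasoning
      identity : ∀ n → 8 + n * (n + 2 * 2 + 1) ≡ 4 + suc n * (3 + suc n)
      identity = solve-∀

  t<|P||L| : t < length minimalGenerators * length smallElements
  t<|P||L| = *-cancelˡ-< 12 t _ (begin-strict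
    12 * t                                               <⟨ m<m+n (12 * t) z<s ⟩
    12 * t + suc excess                                  ≡⟨ identity n ⟨
    (4 + q * (3 + q)) * (q * (13 + q * (9 + q * 2)))     ≡⟨ cong₂ _*_ length-minimalGenerators length-smallElements ⟨
    2 * length minimalGenerators * (6 * length smallElements)
                                                         ≡⟨ regroup (length minimalGenerators) (length smallElements) ⟩
    12 * (length minimalGenerators * length smallElements) ∎)
    where
      open ≤-Reasoning
      -- 12|P||L| − 12t − 1, written in n = q − 1, where all its coefficients are positive.
      excess : ℕ
      excess = 23 + n * (104 + n * (161 + n * (104 + n * (25 + n * 2))))
      identity : ∀ n → (4 + suc n * (3 + suc n)) * (suc n * (13 + suc n * (9 + suc n * 2)))
                     ≡ 12 * (suc n * 2 * (suc n * suc (suc n + 3) + 2))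
                       + suc (23 + n * (104 + n * (161 + n * (104 + n * (25 + n * 2)))))
      identity = solve-∀
      regroup : ∀ a b → 2 * a * (6 * b) ≡ 12 * (a * b)
      regroup = solve-∀

open import Data.Integer as ℤ using (ℤ; +_; _+_; _-_; _*_; _^_)
open import Data.Integer.Properties using (pos-+; pos-*; n⊖n≡0; ⊖-monoˡ-<; [+m]-[+n]≡m⊖n; module ≤-Reasoning)
open import Data.Integer.Tactic.RingSolver using (solve-∀)
import Data.Nat as ℕ
open import Data.Nat.Divisibility using (divides)
open import Data.List using (length)
open import Data.Product using (_,_)
open import Relation.Binary.PropositionalEquality using (refl; sym; trans; cong; cong₂; subst; module ≡-Reasoning)

pos-quadratic : ∀ a b x → + (a ℕ.+ x ℕ.* (b ℕ.+ x)) ≡ + a + + x * (+ b + + x)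
pos-quadratic a b x = begin
  + (a ℕ.+ x ℕ.* (b ℕ.+ x))        ≡⟨ pos-+ a _ ⟩
  + a + + (x ℕ.* (b ℕ.+ x))        ≡⟨ cong (λ z → + a + z) (pos-* x _) ⟩
  + a + + x * + (b ℕ.+ x)          ≡⟨ cong (λ z → + a + + x * z) (pos-+ b x) ⟩
  + a + + x * (+ b + + x)          ∎
  where open ≡-Reasoning

pos-cubic : ∀ a b x → + (x ℕ.* (a ℕ.+ x ℕ.* (b ℕ.+ x ℕ.* 2))) ≡ + x * (+ a + + x * (+ b + + x * + 2))
pos-cubic a b x = begin
  + (x ℕ.* (a ℕ.+ x ℕ.* (b ℕ.+ x ℕ.* 2)))        ≡⟨ pos-* x _ ⟩
  + x * + (a ℕ.+ x ℕ.* (b ℕ.+ x ℕ.* 2))          ≡⟨ cong (λ z → + x * z) (pos-+ a _) ⟩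
  + x * (+ a + + (x ℕ.* (b ℕ.+ x ℕ.* 2)))        ≡⟨ cong (λ z → + x * (+ a + z)) (pos-* x _) ⟩
  + x * (+ a + + x * + (b ℕ.+ x ℕ.* 2))          ≡⟨ cong (λ z → + x * (+ a + + x * z)) (pos-+ b _) ⟩
  + x * (+ a + + x * (+ b + + (x ℕ.* 2)))        ≡⟨ cong (λ z → + x * (+ a + + x * (+ b + z))) (pos-* x 2) ⟩
  + x * (+ a + + x * (+ b + + x * + 2))          ∎
  where open ≡-Reasoning

module WilfNumber (n : ℕ) where

  open SemigroupSp n

  |P| : ℕ
  |P| = length minimalGenerators

  |L| : ℕ
  |L| = length smallElements

  wilf : ℤ
  wilf = + (|P| ℕ.* |L|) - + t

  isWilfNumber : IsWilfNumber S wilf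
  isWilfNumber =
    t , smallElements , minimalGenerators , conductor , smallElements-enumerate , minimalGenerators-enumerate , refl

  wilf-formula : + 192 * wilf ≡ (+ (q ℕ.* 2)) ^ 5 + + 15 * (+ (q ℕ.* 2)) ^ 4 + + 48 * (+ (q ℕ.* 2)) ^ 3
                                 - + 84 * (+ (q ℕ.* 2)) ^ 2 + + 32 * + (q ℕ.* 2)
  wilf-formula = begin
    + 192 * (+ (|P| ℕ.* |L|) - + t)                    ≡⟨ cong₂ (λ a b → + 192 * (a - b)) (pos-* |P| |L|) +t ⟩
    + 192 * (+ |P| * + |L| - T)                         ≡⟨ split (+ |P|) (+ |L|) T ⟩
    + 16 * ((+ 2 * + |P|) * (+ 6 * + |L|)) - + 192 * T  ≡⟨ cong₂ (λ a b → + 16 * (a * b) - + 192 * T) 2|P| 6|L| ⟩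
    + 16 * (P₂ * L₆) - + 192 * T                        ≡⟨ expand Q ⟩
    R (Q * + 2)                                         ≡⟨ cong R (pos-* q 2) ⟨
    R (+ (q ℕ.* 2))                                     ∎
    where
      open ≡-Reasoning
      Q P₂ L₆ T : ℤ
      Q  = + q
      P₂ = + 4 + Q * (+ 3 + Q)
      L₆ = Q * (+ 13 + Q * (+ 9 + Q * + 2))
      T  = Q * (+ 4 + Q * (+ 8 + Q * + 2))
      R : ℤ → ℤ
      R p = p ^ 5 + + 15 * p ^ 4 + + 48 * p ^ 3 - + 84 * p ^ 2 + + 32 * p
      +t : + t ≡ T
      +t = trans (cong +_ t-cubic) (pos-cubic 4 8 q)
      2|P| : + 2 * + |P| ≡ P₂
      2|P| = trans (sym (pos-* 2 |P|)) (trans (cong +_ length-minimalGenerators) (pos-quadratic 4 3 q))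
      6|L| : + 6 * + |L| ≡ L₆
      6|L| = trans (sym (pos-* 6 |L|)) (trans (cong +_ length-smallElements) (pos-cubic 13 9 q))
      split : ∀ P L T → + 192 * (P * L - T) ≡ + 16 * ((+ 2 * P) * (+ 6 * L)) - + 192 * T
      split = solve-∀
      expand : ∀ Q → + 16 * ((+ 4 + Q * (+ 3 + Q)) * (Q * (+ 13 + Q * (+ 9 + Q * + 2))))
                       - + 192 * (Q * (+ 4 + Q * (+ 8 + Q * + 2)))
                     ≡ (Q * + 2) * ((Q * + 2) * ((Q * + 2) * ((Q * + 2) * ((Q * + 2) * + 1))))
                       + + 15 * ((Q * + 2) * ((Q * + 2) * ((Q * + 2) * ((Q * + 2) * + 1))))
                       + + 48 * ((Q * + 2) * ((Q * + 2) * ((Q * + 2) * + 1)))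
                       - + 84 * ((Q * + 2) * ((Q * + 2) * + 1))
                       + + 32 * (Q * + 2)
      expand = solve-∀

  0<wilf : + 0 ℤ.< wilf
  0<wilf = begin-strict
    + 0                ≡⟨ n⊖n≡0 t ⟨
    t ℤ.⊖ t            <⟨ ⊖-monoˡ-< t t<|P||L| ⟩
    |P| ℕ.* |L| ℤ.⊖ t  ≡⟨ [+m]-[+n]≡m⊖n (|P| ℕ.* |L|) t ⟨
    wilf               ∎
    where open ≤-Reasoning

proposition3p23 : (p : ℕ) → 0 < p → 2 ∣ p →
    Σ ℤ λ w → IsWilfNumber (Sp p) w ×
      (+ 192 * w ≡ (+ p) ^ 5 + + 15 * (+ p) ^ 4 + + 48 * (+ p) ^ 3 - + 84 * (+ p) ^ 2 + + 32 * + p) ×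
      (ℤ.+ 0 ℤ.< w)
proposition3p23 .(0 ℕ.* 2)       ()  (divides 0 refl)
proposition3p23 .(ℕ.suc n ℕ.* 2) _   (divides (ℕ.suc n) refl) =
  wilf , subst (λ S → IsWilfNumber S wilf) (sym Sp≡S) isWilfNumber , wilf-formula , 0<wilf
  where
    open SemigroupSp n using (Sp≡S)
    open WilfNumber n
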